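{- Let $\mathcal{F}$ be a class of $k$-transitive $\mathrm{A}$-frames and $\mathcal{G}$ a class of $n$-transitive $\mathrm{B}$-frames ($\mathrm{A},\mathrm{B}$ disjoint finite alphabets). If $\mathrm{Log}(\mathcal{F}\times\mathcal{G})$ is locally tabular, then $\mathcal{F}^*\times\mathcal{G}^*$ has the reducible path property, and $\mathcal{F}\times\mathcal{G}\models\mathrm{rp}_m(k,n)$ for some $m$.
   Context: For a frame $F$ on $X$, $R_F$ is the union of its relations, $R^{\le m}=\bigcup_{i\le m}R^i$, $R^*$ the reflexive transitive closure; $F$ is $k$-transitive if $R_F^{\le k}=R_F^*$; $F^*=(X,R_F^*)$. For an $\mathrm{A}$-frame $F$ and $\mathrm{B}$-frame $G$, $F\times G$ on $X\times Y$ has each $\mathrm{A}$-relation acting on the first coordinate (second fixed) and each $\mathrm{B}$-relation on the second coordinate (first fixed); $\mathcal{F}\times\mathcal{G}$ and $\mathcal{F}^*\times\mathcal{G}^*$ are the corresponding classes of products. $\mathrm{Log}$ of a class is the set of formulas valid in all its frames; a logic is locally tabular if for every finite $k$ it has finitely many pairwise nonequivalent formulas in $k$ variables. $\mathrm{RP}_m$: for all $x_0,\dots,x_{m+1}$, if $x_0Rx_1R\cdots Rx_{m+1}$ then $x_i=x_j$ for some $i<j\le m+1$ or $x_iRx_{j+1}$ for some $i<j\le m$; a class has the reducible path property if for some fixed $m$, $\mathrm{RP}_m$ holds for the union of relations of each of its frames. Notation: $\lozenge_{\mathrm{C}}\varphi=\bigvee_{\lozenge\in\mathrm{C}}\lozenge\varphi$,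 $\lozenge^{\le j}\varphi=\bigvee_{i\le j}\lozenge^i\varphi$; $\mathrm{rp}_m(\lozenge)$ is $p_0\wedge\lozenge(p_1\wedge\lozenge(p_2\wedge\dots\wedge\lozenge p_{m+1})\dots)\to\bigvee_{i<j\le m+1}\lozenge^i(p_i\wedge p_j)\vee\bigvee_{i<j\le m}\lozenge^i(p_i\wedge\lozenge p_{j+1})$, and $\mathrm{rp}_m(k,n)=\mathrm{rp}_m(\bar\lozenge)$ where $\bar\lozenge\varphi$ abbreviates $\lozenge_{\mathrm{A}}^{\le k}\varphi\vee\lozenge_{\mathrm{B}}^{\le n}\varphi$. -}

module Defs where

open import Level using (0ℓ)
open import Data.Nat using (ℕ; zero; suc; _<_; _≤_)
open import Data.Fin using (Fin)
open import Data.List using (List; []; _∷_; map; concatMap; upTo; allFin)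
open import Data.List.Membership.Propositional using (_∈_)
open import Data.Product using (Σ; ∃; _×_; _,_; Σ-syntax)
open import Data.Sum using (_⊎_; inj₁; inj₂)
open import Data.Unit using (⊤)
open import Data.Empty using (⊥)
open import Relation.Binary.PropositionalEquality using (_≡_)

record Frame (Σ : Set) : Set₁ where
  field
    W : Set
    R : Σ → W → W → Set
open Frame public

Class : Set → Set₂
Class Σ = Frame Σ → Set₁

Rel : Set → Set₁
Rel X = X → X → Set

_^_ : {X : Set} → Rel X → ℕ → Rel X
(R ^ zero) x y = x ≡ y
(R ^ suc i) x y = Σ[ z ∈ _ ] (R x z × (R ^ i) z y)

_^≤_ : {X : Set} → Rel X → ℕ → Rel X
(R ^≤ m) x y = Σ[ i ∈ ℕ ] (i ≤ m × (R ^ i) x y)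

Star : {X : Set} → Rel X → Rel X
Star R x y = Σ[ i ∈ ℕ ] ((R ^ i) x y)

RU : {Σ : Set} (F : Frame Σ) → Rel (W F)
RU {Σ} F x y = Σ[ a ∈ Σ ] R F a x y

KTransitive : {Σ : Set} → ℕ → Frame Σ → Set
KTransitive k F = ∀ x y → ((RU F ^≤ k) x y → Star (RU F) x y)
                        × (Star (RU F) x y → (RU F ^≤ k) x y)

StarFrame : {Σ : Set} → Frame Σ → Frame ⊤
StarFrame F = record { W = W F ; R = λ _ → Star (RU F) }

_⊗_ : {A B : Set} → Frame A → Frame B → Frame (A ⊎ B)
_⊗_ {A} {B} F G = record { W = W F × W G ; R = rel }
  where
  rel : A ⊎ B → W F × W G → W F × W G → Set
  rel (inj₁ a) (x , y) (x' , y') = R F a x x' × y ≡ y'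
  rel (inj₂ b) (x , y) (x' , y') = x ≡ x' × R G b y y'

-- RP_m for a relation, written with x : ℕ → X (only x_0..x_{m+1} matter)

RP : {X : Set} → ℕ → Rel X → Set
RP {X} m R = (x : ℕ → X)
  → (∀ i → i ≤ m → R (x i) (x (suc i)))
  → (Σ[ i ∈ ℕ ] Σ[ j ∈ ℕ ] (i < j × j ≤ suc m × x i ≡ x j))
    ⊎ (Σ[ i ∈ ℕ ] Σ[ j ∈ ℕ ] (i < j × j ≤ m × R (x i) (x (suc j))))

StarProductRP : {A B : Set} → Class A → Class B → Set₁
StarProductRP 𝓕 𝓖 = Σ[ m ∈ ℕ ] (∀ F G → 𝓕 F → 𝓖 G → RP m (RU (StarFrame F ⊗ StarFrame G)))

data Fm (Σ V : Set) : Set where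
  var  : V → Fm Σ V
  ⊥'   : Fm Σ V
  ⊤'   : Fm Σ V
  _∧'_ : Fm Σ V → Fm Σ V → Fm Σ V
  _∨'_ : Fm Σ V → Fm Σ V → Fm Σ V
  _⇒'_ : Fm Σ V → Fm Σ V → Fm Σ V
  ◇    : Σ → Fm Σ V → Fm Σ V

infixr 6 _∧'_
infixr 5 _∨'_
infixr 4 _⇒'_

_⇔'_ : {Σ V : Set} → Fm Σ V → Fm Σ V → Fm Σ V
φ ⇔' ψ = (φ ⇒' ψ) ∧' (ψ ⇒' φ)

Sat : {Σ V : Set} (F : Frame Σ) → (V → W F → Set) → W F → Fm Σ V → Set
Sat F v x (var p)  = v p x
Sat F v x ⊥'       = ⊥
Sat F v x ⊤'       = ⊤
Sat F v x (φ ∧' ψ) = Sat F v x φ × Sat F v x ψ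
Sat F v x (φ ∨' ψ) = Sat F v x φ ⊎ Sat F v x ψ
Sat F v x (φ ⇒' ψ) = Sat F v x φ → Sat F v x ψ
Sat F v x (◇ a φ)  = Σ[ y ∈ W F ] (R F a x y × Sat F v y φ)

_⊨_ : {Σ V : Set} → Frame Σ → Fm Σ V → Set₁
_⊨_ {Σ} {V} F φ = (v : V → W F → Set) (x : W F) → Sat F v x φ

LogProd : {A B V : Set} → Class A → Class B → Fm (A ⊎ B) V → Set₁
LogProd 𝓕 𝓖 φ = ∀ F G → 𝓕 F → 𝓖 G → (F ⊗ G) ⊨ φ

LocallyTabularProd : {A B : Set} → Class A → Class B → Set₁
LocallyTabularProd {A} {B} 𝓕 𝓖 =
  (k : ℕ) → Σ[ L ∈ List (Fm (A ⊎ B) (Fin k)) ]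
    ((φ : Fm (A ⊎ B) (Fin k)) → Σ[ ψ ∈ Fm (A ⊎ B) (Fin k) ] (ψ ∈ L × LogProd 𝓕 𝓖 (φ ⇔' ψ)))

bigOr : {Σ V : Set} → List (Fm Σ V) → Fm Σ V
bigOr []       = ⊥'
bigOr (φ ∷ φs) = φ ∨' bigOr φs

iter : {Σ V : Set} → ℕ → (Fm Σ V → Fm Σ V) → Fm Σ V → Fm Σ V
iter zero    f φ = φ
iter (suc i) f φ = f (iter i f φ)

dia≤ : {Σ V : Set} → ℕ → (Fm Σ V → Fm Σ V) → Fm Σ V → Fm Σ V
dia≤ j f φ = bigOr (map (λ i → iter i f φ) (upTo (suc j)))

chain : {Σ : Set} → (Fm Σ ℕ → Fm Σ ℕ) → ℕ → ℕ → Fm Σ ℕ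
chain f i zero    = var i
chain f i (suc r) = var i ∧' f (chain f (suc i) r)

pairs : ℕ → List (ℕ × ℕ)
pairs N = concatMap (λ j → map (λ i → (i , j)) (upTo j)) (upTo (suc N))

rp : {Σ : Set} → ℕ → (Fm Σ ℕ → Fm Σ ℕ) → Fm Σ ℕ
rp m f = chain f 0 (suc m) ⇒'
  (bigOr (map (λ { (i , j) → iter i f (var i ∧' var j) }) (pairs (suc m)))
   ∨' bigOr (map (λ { (i , j) → iter i f (var i ∧' f (var (suc j))) }) (pairs m)))

diaA : {a b : ℕ} {V : Set} → Fm (Fin a ⊎ Fin b) V → Fm (Fin a ⊎ Fin b) V
diaA φ = bigOr (map (λ c → ◇ (inj₁ c) φ) (allFin _))

diaB : {a b : ℕ} {V : Set} → Fm (Fin a ⊎ Fin b) V → Fm (Fin a ⊎ Fin b) V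
diaB φ = bigOr (map (λ c → ◇ (inj₂ c) φ) (allFin _))

rpkn : (a b : ℕ) → ℕ → ℕ → ℕ → Fm (Fin a ⊎ Fin b) ℕ
rpkn a b m k n = rp m (λ φ → dia≤ k (diaA {a} {b}) φ ∨' dia≤ n (diaB {a} {b}) φ)

-- Under k- and n-transitivity the compound diamond ◇̄ φ = ◇_A^{≤k} φ ∨ ◇_B^{≤n} φ is exactly
-- the diamond of the relation R of F^* × G^*, so rp_m(k,n) is the modal counterpart of RP_m and
-- the second claim follows from the first.
-- For the first, colour each index by its residue mod 3 and let ψ_s be the three-variable formula
-- "a ◇̄-chain of length s whose points carry the colours 0, 1, 2, 0, …".  On an R-path
-- x_0 … x_N without shortcuts, every R-edge between points of the path joins indices at most one
-- apart (an edge going back can be reversed, since the path is monotone in both coordinates), so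
-- under the valuation colouring x_j by colour j, ψ_s holds at x_0 iff s ≤ N.  Local tabularity
-- makes two of ψ_1, ψ_2, … equivalent, say ψ_{m+1} and ψ_{j+1} with m < j; a shortcut-free path
-- of length m + 1 would separate them, hence RP_m holds.
module Submission where

open import Defs
open import Level using (0ℓ)
open import Axiom.ExcludedMiddle using (ExcludedMiddle)
open import Data.Nat using (ℕ; zero; suc; _+_; _≤_; _<_; z≤n; s≤s; s≤s⁻¹)
open import Data.Nat.Properties
open import Data.Fin using (Fin; toℕ)
open import Data.Fin.Properties using (pigeonhole)
open import Data.Product using (Σ-syntax; _×_; _,_; proj₁; proj₂)
open import Data.Product.Relation.Binary.Pointwise.NonDependent using (Pointwise; ×-transitive)
open import Data.Sum using (_⊎_; inj₁; inj₂)
open import Data.Unit using (tt)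
open import Data.Empty using (⊥-elim)
open import Data.List using (List; _∷_; map; upTo; allFin; length)
open import Data.List.Relation.Unary.Any using (Any; here; there; index)
open import Data.List.Relation.Unary.Any.Properties using (map⁺; map⁻)
open import Data.List.Membership.Propositional using (_∈_; find; lose)
open import Data.List.Membership.Propositional.Properties using (∈-map⁺; ∈-upTo⁺; ∈-upTo⁻; ∈-allFin; ∈-concatMap⁺)
open import Data.List.Membership.Setoid.Properties using (index-injective)
open import Function.Base using (_∘_)
open import Function.Bundles using (_⇔_; mk⇔; module Equivalence)
import Function.Properties.Equivalence as ⇔
open import Relation.Binary.PropositionalEquality
open import Relation.Nullary using (¬_; yes; no)
open import Relation.Binary using (tri<; tri≈; tri>)
open import Relation.Nullary.Decidable using (decidable-stable)

open Equivalence using (to; from)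

module _ {Σ V : Set} {F : Frame Σ} {v : V → W F → Set} {x : W F} where

  Sat-bigOr : (φs : List (Fm Σ V)) → Sat F v x (bigOr φs) ⇔ Any (Sat F v x) φs
  Sat-bigOr φs = mk⇔ (⇒ φs) ⇐
    where
    ⇒ : ∀ φs → Sat F v x (bigOr φs) → Any (Sat F v x) φs
    ⇒ (φ ∷ φs) (inj₁ h) = here h
    ⇒ (φ ∷ φs) (inj₂ h) = there (⇒ φs h)
    ⇐ : ∀ {φs} → Any (Sat F v x) φs → Sat F v x (bigOr φs)
    ⇐ (here h)  = inj₁ h
    ⇐ (there p) = inj₂ (⇐ p)

  Sat-bigOr-map : {C : Set} (g : C → Fm Σ V) (cs : List C) →
                  Sat F v x (bigOr (map g cs)) ⇔ Any (Sat F v x ∘ g) cs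
  Sat-bigOr-map g cs = ⇔.trans (Sat-bigOr (map g cs)) (mk⇔ map⁻ map⁺)

∈-pairs : ∀ {i j N} → i < j → j ≤ N → (i , j) ∈ pairs N
∈-pairs {i} {j} i<j j≤N =
  ∈-concatMap⁺ (λ j → map (λ i → i , j) (upTo j)) (lose (∈-upTo⁺ (s≤s j≤N)) (∈-map⁺ (λ i → i , j) (∈-upTo⁺ i<j)))

IsPath : {X : Set} → Rel X → (ℕ → X) → ℕ → Set
IsPath S x N = ∀ t → t < N → S (x t) (x (suc t))

module _ {X : Set} {S : Rel X} where

  ^-trans : ∀ i {j x y z} → (S ^ i) x y → (S ^ j) y z → (S ^ (i + j)) x z
  ^-trans zero    refl        q = q
  ^-trans (suc i) (w , s , p) q = w , s , ^-trans i p q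

  Star-trans : ∀ {x y z} → Star S x y → Star S y z → Star S x z
  Star-trans (i , p) (j , q) = i + j , ^-trans i p q

  IsPath-≤ : ∀ {x M N} → M ≤ N → IsPath S x N → IsPath S x M
  IsPath-≤ M≤N path t t<M = path t (<-≤-trans t<M M≤N)

  IsPath⇒^ : ∀ x N → IsPath S x N → (S ^ N) (x 0) (x N)
  IsPath⇒^ x zero    path = refl
  IsPath⇒^ x (suc N) path = x 1 , path 0 (s≤s z≤n) , IsPath⇒^ (x ∘ suc) N (λ t t<N → path (suc t) (s≤s t<N))

  IsPath⇒Star : ∀ {x N} → IsPath S x N → ∀ {i j} → i ≤ j → j ≤ N → Star S (x i) (x j)
  IsPath⇒Star path {j = zero}  z≤n _ = 0 , refl
  IsPath⇒Star path {j = suc j} i≤j j<N with m≤n⇒m<n∨m≡n i≤j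
  ... | inj₂ refl        = 0 , refl
  ... | inj₁ (s≤s i≤j′) =
    Star-trans (IsPath⇒Star path i≤j′ (<⇒≤ j<N)) (1 , _ , path j j<N , refl)

SatDia : {Σ V : Set} (H : Frame Σ) → (V → W H → Set) → Rel (W H) → W H → Fm Σ V → Set
SatDia H v S u φ = Σ[ w ∈ W H ] (S u w × Sat H v w φ)

Defines : {Σ : Set} (H : Frame Σ) (V : Set) → (Fm Σ V → Fm Σ V) → Rel (W H) → Set₁
Defines H V f S = ∀ (v : V → W H → Set) φ u → Sat H v u (f φ) ⇔ SatDia H v S u φ

module _ {Σ V : Set} {H : Frame Σ} where

  Defines-resp : ∀ {f} {S T : Rel (W H)} → (∀ u w → S u w ⇔ T u w) →
                 Defines H V f S → Defines H V f T
  Defines-resp S⇔T f-defines v φ u = ⇔.trans (f-defines v φ u)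
    (mk⇔ (λ (w , s , h) → w , to (S⇔T u w) s , h) (λ (w , t , h) → w , from (S⇔T u w) t , h))

  ∨-defines : ∀ {f g} {S T : Rel (W H)} → Defines H V f S → Defines H V g T →
              Defines H V (λ φ → f φ ∨' g φ) (λ u w → S u w ⊎ T u w)
  ∨-defines {f} {g} {S} {T} f-defines g-defines v φ u = mk⇔ ⇒ ⇐
    where
    ⇒ : Sat H v u (f φ ∨' g φ) → SatDia H v (λ u w → S u w ⊎ T u w) u φ
    ⇒ (inj₁ h) = let w , s , h′ = to (f-defines v φ u) h in w , inj₁ s , h′
    ⇒ (inj₂ h) = let w , t , h′ = to (g-defines v φ u) h in w , inj₂ t , h′
    ⇐ : SatDia H v (λ u w → S u w ⊎ T u w) u φ → Sat H v u (f φ ∨' g φ)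
    ⇐ (w , inj₁ s , h) = inj₁ (from (f-defines v φ u) (w , s , h))
    ⇐ (w , inj₂ t , h) = inj₂ (from (g-defines v φ u) (w , t , h))

  iter-defines : ∀ {f S} → Defines H V f S → ∀ i → Defines H V (iter i f) (S ^ i)
  iter-defines f-defines zero    v φ u = mk⇔ (λ h → u , refl , h) (λ { (_ , refl , h) → h })
  iter-defines {f} {S} f-defines (suc i) v φ u = mk⇔ ⇒ ⇐
    where
    ⇒ : Sat H v u (iter (suc i) f φ) → SatDia H v (S ^ suc i) u φ
    ⇒ h = let z , s , h′ = to (f-defines v _ u) h
              w , p , h″ = to (iter-defines f-defines i v φ z) h′
          in w , (z , s , p) , h″
    ⇐ : SatDia H v (S ^ suc i) u φ → Sat H v u (iter (suc i) f φ)
    ⇐ (w , (z , s , p) , h) = from (f-defines v _ u) (z , s , from (iter-defines f-defines i v φ z) (w , p , h))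

  dia≤-defines : ∀ {f S} → Defines H V f S → ∀ j → Defines H V (dia≤ j f) (S ^≤ j)
  dia≤-defines {f} {S} f-defines j v φ u = mk⇔ ⇒ ⇐
    where
    ⇒ : Sat H v u (dia≤ j f φ) → SatDia H v (S ^≤ j) u φ
    ⇒ h = let i , i∈ , h′ = find (to (Sat-bigOr-map (λ i → iter i f φ) (upTo (suc j))) h)
              w , p , h″ = to (iter-defines f-defines i v φ u) h′
          in w , (i , s≤s⁻¹ (∈-upTo⁻ i∈) , p) , h″
    ⇐ : SatDia H v (S ^≤ j) u φ → Sat H v u (dia≤ j f φ)
    ⇐ (w , (i , i≤j , p) , h) = from (Sat-bigOr-map (λ i → iter i f φ) (upTo (suc j)))
      (lose (∈-upTo⁺ (s≤s i≤j)) (from (iter-defines f-defines i v φ u) (w , p , h)))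

module _ {X Y : Set} where

  onFst : Rel X → Rel (X × Y)
  onFst S (x , y) (x′ , y′) = S x x′ × y ≡ y′

  onSnd : Rel Y → Rel (X × Y)
  onSnd S (x , y) (x′ , y′) = x ≡ x′ × S y y′

  module _ {S : Rel X} where

    onFst-^ : ∀ i {x y x′ y′} → (onFst S ^ i) (x , y) (x′ , y′) ⇔ onFst (S ^ i) (x , y) (x′ , y′)
    onFst-^ zero    = mk⇔ (λ { refl → refl , refl }) (λ { (refl , refl) → refl })
    onFst-^ (suc i) {y = y} = mk⇔
      (λ { ((z , _) , (s , refl) , p) → let q , e = to (onFst-^ i) p in (z , s , q) , e })
      (λ { ((z , s , q) , e) → (z , y) , (s , refl) , from (onFst-^ i) (q , e) })

    onFst-^≤ : ∀ k {x y x′ y′} → (onFst S ^≤ k) (x , y) (x′ , y′) ⇔ onFst (S ^≤ k) (x , y) (x′ , y′)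
    onFst-^≤ k = mk⇔
      (λ (i , i≤k , p) → let q , e = to (onFst-^ i) p in (i , i≤k , q) , e)
      (λ ((i , i≤k , q) , e) → i , i≤k , from (onFst-^ i) (q , e))

  module _ {S : Rel Y} where

    onSnd-^ : ∀ i {x y x′ y′} → (onSnd S ^ i) (x , y) (x′ , y′) ⇔ onSnd (S ^ i) (x , y) (x′ , y′)
    onSnd-^ zero    = mk⇔ (λ { refl → refl , refl }) (λ { (refl , refl) → refl })
    onSnd-^ (suc i) {x = x} = mk⇔
      (λ { ((_ , z) , (refl , s) , p) → let e , q = to (onSnd-^ i) p in e , (z , s , q) })
      (λ { (e , (z , s , q)) → (x , z) , (refl , s) , from (onSnd-^ i) (e , q) })

    onSnd-^≤ : ∀ n {x y x′ y′} → (onSnd S ^≤ n) (x , y) (x′ , y′) ⇔ onSnd (S ^≤ n) (x , y) (x′ , y′)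
    onSnd-^≤ n = mk⇔
      (λ (i , i≤n , p) → let e , q = to (onSnd-^ i) p in e , (i , i≤n , q))
      (λ (e , (i , i≤n , q)) → i , i≤n , from (onSnd-^ i) (e , q))

R* : {A B : Set} (F : Frame A) (G : Frame B) → Rel (W F × W G)
R* F G = RU (StarFrame F ⊗ StarFrame G)

◇̄ : {a b : ℕ} {V : Set} → ℕ → ℕ → Fm (Fin a ⊎ Fin b) V → Fm (Fin a ⊎ Fin b) V
◇̄ {a} {b} k n φ = dia≤ k (diaA {a} {b}) φ ∨' dia≤ n (diaB {a} {b}) φ

module _ {a b : ℕ} {V : Set} (F : Frame (Fin a)) (G : Frame (Fin b)) where

  diaA-defines : Defines (F ⊗ G) V diaA (onFst (RU F))
  diaA-defines v φ u = mk⇔ ⇒ ⇐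
    where
    ⇒ : Sat (F ⊗ G) v u (diaA φ) → SatDia (F ⊗ G) v (onFst (RU F)) u φ
    ⇒ h = let c , _ , ((x′ , y′) , (s , e) , h′) = find (to (Sat-bigOr-map _ (allFin a)) h)
          in (x′ , y′) , ((c , s) , e) , h′
    ⇐ : SatDia (F ⊗ G) v (onFst (RU F)) u φ → Sat (F ⊗ G) v u (diaA φ)
    ⇐ ((x′ , y′) , ((c , s) , e) , h) = from (Sat-bigOr-map _ (allFin a)) (lose (∈-allFin c) ((x′ , y′) , (s , e) , h))

  diaB-defines : Defines (F ⊗ G) V diaB (onSnd (RU G))
  diaB-defines v φ u = mk⇔ ⇒ ⇐
    where
    ⇒ : Sat (F ⊗ G) v u (diaB φ) → SatDia (F ⊗ G) v (onSnd (RU G)) u φ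
    ⇒ h = let c , _ , ((x′ , y′) , (e , s) , h′) = find (to (Sat-bigOr-map _ (allFin b)) h)
          in (x′ , y′) , (e , (c , s)) , h′
    ⇐ : SatDia (F ⊗ G) v (onSnd (RU G)) u φ → Sat (F ⊗ G) v u (diaB φ)
    ⇐ ((x′ , y′) , (e , (c , s)) , h) = from (Sat-bigOr-map _ (allFin b)) (lose (∈-allFin c) ((x′ , y′) , (e , s) , h))

  ◇̄-defines : ∀ {k n} → KTransitive k F → KTransitive n G → Defines (F ⊗ G) V (◇̄ k n) (R* F G)
  ◇̄-defines {k} {n} k-trans n-trans =
    Defines-resp {f = ◇̄ k n} ≤k⊎≤n⇔R*
      (∨-defines {f = dia≤ k diaA} {g = dia≤ n diaB}
        (dia≤-defines {f = diaA} diaA-defines k) (dia≤-defines {f = diaB} diaB-defines n))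
    where
    ≤k⊎≤n : Rel (W F × W G)
    ≤k⊎≤n u w = (onFst (RU F) ^≤ k) u w ⊎ (onSnd (RU G) ^≤ n) u w
    ≤k⊎≤n⇔R* : ∀ u w → ≤k⊎≤n u w ⇔ R* F G u w
    ≤k⊎≤n⇔R* (x , y) (x′ , y′) = mk⇔ ⇒ ⇐
      where
      ⇒ : ≤k⊎≤n (x , y) (x′ , y′) → R* F G (x , y) (x′ , y′)
      ⇒ (inj₁ p) = let q , e = to (onFst-^≤ k) p in inj₁ tt , proj₁ (k-trans x x′) q , e
      ⇒ (inj₂ p) = let e , q = to (onSnd-^≤ n) p in inj₂ tt , e , proj₁ (n-trans y y′) q
      ⇐ : R* F G (x , y) (x′ , y′) → ≤k⊎≤n (x , y) (x′ , y′)
      ⇐ (inj₁ tt , q , e) = inj₁ (from (onFst-^≤ k) (proj₂ (k-trans x x′) q , e))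
      ⇐ (inj₂ tt , e , q) = inj₂ (from (onSnd-^≤ n) (e , proj₂ (n-trans y y′) q))

WithinOne : ℕ → ℕ → Set
WithinOne i j = j ≡ suc i ⊎ j ≡ i ⊎ i ≡ suc j

module _ {A B : Set} (F : Frame A) (G : Frame B) where

  private
    Reach : Rel (W F × W G)
    Reach = Pointwise (Star (RU F)) (Star (RU G))

  R*⇒Reach : ∀ {u w} → R* F G u w → Reach u w
  R*⇒Reach (inj₁ tt , s , refl) = s , (0 , refl)
  R*⇒Reach (inj₂ tt , refl , s) = (0 , refl) , s

  Star-R*⇒Reach : ∀ {u w} → Star (R* F G) u w → Reach u w
  Star-R*⇒Reach (zero  , refl)      = (0 , refl) , (0 , refl)
  Star-R*⇒Reach (suc i , _ , r , p) =
    ×-transitive {R = Star (RU F)} {S = Star (RU G)} Star-trans Star-trans (R*⇒Reach r) (Star-R*⇒Reach (i , p))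

  R*-reverse : ∀ {u w} → Reach u w → R* F G w u → R* F G u w
  R*-reverse (s , _) (inj₁ tt , _ , e) = inj₁ tt , s , sym e
  R*-reverse (_ , s) (inj₂ tt , e , _) = inj₂ tt , sym e , s

  module _ (x : ℕ → W F × W G) (r : ℕ) (path : IsPath (R* F G) x (suc r))
           (noShortcut : ∀ i j → i < j → j ≤ r → ¬ R* F G (x i) (x (suc j))) where

    forward-bound : ∀ {i j} → j ≤ suc r → R* F G (x i) (x j) → j ≤ suc i
    forward-bound {i} {j} j≤ e with j ≤? suc i
    ... | yes j≤1+i = j≤1+i
    ... | no  j≰1+i with ≰⇒> j≰1+i
    ... | s≤s i<j′ = ⊥-elim (noShortcut _ _ i<j′ (s≤s⁻¹ j≤) e)

    shortcutFree⇒withinOne : ∀ {i j} → i ≤ suc r → j ≤ suc r → R* F G (x i) (x j) → WithinOne i j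
    shortcutFree⇒withinOne {i} {j} i≤ j≤ e with <-cmp j i
    ... | tri< j<i _ _ = inj₂ (inj₂ (≤-antisym (forward-bound i≤ (R*-reverse reach e)) j<i))
      where reach = Star-R*⇒Reach (IsPath⇒Star path (<⇒≤ j<i) i≤)
    ... | tri≈ _ j≡i _ = inj₂ (inj₁ j≡i)
    ... | tri> _ _ i<j = inj₁ (≤-antisym (forward-bound j≤ e) i<j)

colour : ℕ → Fin 3
colour 0                   = Fin.zero
colour 1                   = Fin.suc Fin.zero
colour 2                   = Fin.suc (Fin.suc Fin.zero)
colour (suc (suc (suc n))) = colour n

colour-suc : ∀ n → colour n ≢ colour (suc n)
colour-suc 0 ()
colour-suc 1 ()
colour-suc 2 ()
colour-suc (suc (suc (suc n))) = colour-suc n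

colour-suc-suc : ∀ n → colour n ≢ colour (suc (suc n))
colour-suc-suc 0 ()
colour-suc-suc 1 ()
colour-suc-suc 2 ()
colour-suc-suc (suc (suc (suc n))) = colour-suc-suc n

colour-withinOne : ∀ {i j} → WithinOne i j → colour j ≡ colour (suc i) → j ≡ suc i
colour-withinOne         (inj₁ j≡1+i)       _ = j≡1+i
colour-withinOne {i}     (inj₂ (inj₁ refl)) c = ⊥-elim (colour-suc i c)
colour-withinOne {j = j} (inj₂ (inj₂ refl)) c = ⊥-elim (colour-suc-suc j c)

colourChain : {Σ : Set} → (Fm Σ (Fin 3) → Fm Σ (Fin 3)) → ℕ → ℕ → Fm Σ (Fin 3)
colourChain f i zero    = var (colour i)
colourChain f i (suc s) = var (colour i) ∧' f (colourChain f (suc i) s)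

pathColouring : {X : Set} → (ℕ → X) → ℕ → Fin 3 → X → Set
pathColouring x N c w = Σ[ j ∈ ℕ ] (j ≤ N × colour j ≡ c × w ≡ x j)

module _ {Σ : Set} {H : Frame Σ} {f : Fm Σ (Fin 3) → Fm Σ (Fin 3)} {S : Rel (W H)}
         (f-defines : Defines H (Fin 3) f S)
         (x : ℕ → W H) (N : ℕ) (path : IsPath S x N)
         (withinOne : ∀ {i j} → i ≤ N → j ≤ N → S (x i) (x j) → WithinOne i j) where

  colourChain-head : ∀ i s {w} → Sat H (pathColouring x N) w (colourChain f i s) → pathColouring x N (colour i) w
  colourChain-head i zero    h       = h
  colourChain-head i (suc s) (h , _) = h

  colourChain-along : ∀ s i → i + s ≤ N → Sat H (pathColouring x N) (x i) (colourChain f i s)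
  colourChain-along zero    i i+0≤N = i , subst (_≤ N) (+-identityʳ i) i+0≤N , refl , refl
  colourChain-along (suc s) i i+s+1≤N =
    (i , <⇒≤ i<N , refl , refl) ,
    from (f-defines _ _ (x i)) (x (suc i) , path i i<N , colourChain-along s (suc i) i+1+s≤N)
    where
    i+1+s≤N : suc i + s ≤ N
    i+1+s≤N = subst (_≤ N) (+-suc i s) i+s+1≤N
    i<N : i < N
    i<N = m+n≤o⇒m≤o (suc i) i+1+s≤N

  -- The colours force the witness of each ◇̄ to be the next point of the path.
  colourChain-bound : ∀ s i → i ≤ N → Sat H (pathColouring x N) (x i) (colourChain f i s) → i + s ≤ N
  colourChain-bound zero    i i≤N _ = subst (_≤ N) (sym (+-identityʳ i)) i≤N
  colourChain-bound (suc s) i i≤N (_ , h) with to (f-defines _ _ (x i)) h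
  ... | w , e , h′ with colourChain-head (suc i) s h′
  ... | j , j≤N , cj , refl with colour-withinOne (withinOne i≤N j≤N e) cj
  ... | refl = subst (_≤ N) (sym (+-suc i s)) (colourChain-bound s (suc i) j≤N h′)

  colourChain-start : ∀ s → Sat H (pathColouring x N) (x 0) (colourChain f 0 s) ⇔ s ≤ N
  colourChain-start s = mk⇔ (colourChain-bound s 0 z≤n) (colourChain-along s 0)

module _ {Σ : Set} {H : Frame Σ} {f : Fm Σ ℕ → Fm Σ ℕ} {S : Rel (W H)}
         (f-defines : Defines H ℕ f S) where

  iter-along : ∀ {v φ} (x : ℕ → W H) i → IsPath S x i → Sat H v (x i) φ → Sat H v (x 0) (iter i f φ)
  iter-along {v} x i path h = from (iter-defines f-defines i v _ (x 0)) (x i , IsPath⇒^ x i path , h)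

  chain-path : ∀ {v} r i u → Sat H v u (chain f i r) →
    Σ[ x ∈ (ℕ → W H) ] (x 0 ≡ u × (∀ t → t ≤ r → v (i + t) (x t)) × IsPath S x r)
  chain-path {v} zero i u h = (λ _ → u) , refl , label , λ _ ()
    where
    label : ∀ t → t ≤ 0 → v (i + t) u
    label zero _ = subst (λ q → v q u) (sym (+-identityʳ i)) h
  chain-path {v} (suc r) i u (h₀ , h) with to (f-defines v _ u) h
  ... | w , e , h′ with chain-path r (suc i) w h′
  ... | x , refl , labels , path = x′ , refl , labels′ , path′
    where
    x′ : ℕ → W H
    x′ zero    = u
    x′ (suc t) = x t
    labels′ : ∀ t → t ≤ suc r → v (i + t) (x′ t)
    labels′ zero    _         = subst (λ q → v q u) (sym (+-identityʳ i)) h₀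
    labels′ (suc t) (s≤s t≤r) = subst (λ q → v q (x t)) (sym (+-suc i t)) (labels t t≤r)
    path′ : IsPath S x′ (suc r)
    path′ zero    _         = e
    path′ (suc t) (s≤s t<r) = path t t<r

  rp-valid : ∀ m → RP m S → H ⊨ rp m f
  rp-valid m rpₘ v u h with chain-path (suc m) 0 u h
  ... | x , refl , labels , path with rpₘ x (λ t t≤m → path t (s≤s t≤m))
  ... | inj₁ (i , j , i<j , j≤1+m , xᵢ≡xⱼ) =
    inj₁ (from (Sat-bigOr-map _ (pairs (suc m))) (lose (∈-pairs i<j j≤1+m)
      (iter-along x i (IsPath-≤ {S = S} i≤1+m path)
        (labels i i≤1+m , subst (v j) (sym xᵢ≡xⱼ) (labels j j≤1+m)))))
    where i≤1+m = ≤-trans (<⇒≤ i<j) j≤1+m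
  ... | inj₂ (i , j , i<j , j≤m , shortcut) =
    inj₂ (from (Sat-bigOr-map _ (pairs m)) (lose (∈-pairs i<j j≤m)
      (iter-along x i (IsPath-≤ {S = S} i≤1+m path)
        (labels i i≤1+m , from (f-defines v _ (x i)) (x (suc j) , shortcut , labels (suc j) (s≤s j≤m))))))
    where i≤1+m = ≤-trans (<⇒≤ i<j) (m≤n⇒m≤1+n j≤m)

module _ {A B : Set} {𝓕 : Class A} {𝓖 : Class B} where

  LogProd-⇔'-sym : ∀ {V} {φ ψ : Fm (A ⊎ B) V} → LogProd 𝓕 𝓖 (φ ⇔' ψ) → LogProd 𝓕 𝓖 (ψ ⇔' φ)
  LogProd-⇔'-sym φ⇔ψ F G F∈ G∈ v u = let ⇒ , ⇐ = φ⇔ψ F G F∈ G∈ v u in ⇐ , ⇒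

  LogProd-⇔'-trans : ∀ {V} {φ ψ χ : Fm (A ⊎ B) V} →
                     LogProd 𝓕 𝓖 (φ ⇔' ψ) → LogProd 𝓕 𝓖 (ψ ⇔' χ) → LogProd 𝓕 𝓖 (φ ⇔' χ)
  LogProd-⇔'-trans φ⇔ψ ψ⇔χ F G F∈ G∈ v u =
    let φ⇒ψ , ψ⇒φ = φ⇔ψ F G F∈ G∈ v u
        ψ⇒χ , χ⇒ψ = ψ⇔χ F G F∈ G∈ v u
    in ψ⇒χ ∘ φ⇒ψ , ψ⇒φ ∘ χ⇒ψ

  finiteRepresentatives⇒equivalentPair : {V : Set} (L : List (Fm (A ⊎ B) V)) →
    (∀ φ → Σ[ ψ ∈ Fm (A ⊎ B) V ] (ψ ∈ L × LogProd 𝓕 𝓖 (φ ⇔' ψ))) →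
    (φ : ℕ → Fm (A ⊎ B) V) → Σ[ i ∈ ℕ ] Σ[ j ∈ ℕ ] (i < j × LogProd 𝓕 𝓖 (φ i ⇔' φ j))
  finiteRepresentatives⇒equivalentPair {V} L repr φ =
    let t , t′ , t<t′ , same-slot = pigeonhole (n<1+n (length L)) (index ∘ ∈L ∘ toℕ)
        same-repr = index-injective (setoid _) (∈L (toℕ t)) (∈L (toℕ t′)) same-slot
    in toℕ t , toℕ t′ , t<t′ , via-repr (toℕ t) (toℕ t′) same-repr
    where
    ρ : ℕ → Fm (A ⊎ B) V
    ρ i = proj₁ (repr (φ i))
    ∈L : ∀ i → ρ i ∈ L
    ∈L i = proj₁ (proj₂ (repr (φ i)))
    via-repr : ∀ i j → ρ i ≡ ρ j → LogProd 𝓕 𝓖 (φ i ⇔' φ j)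
    via-repr i j ρᵢ≡ρⱼ = LogProd-⇔'-trans {φ = φ i} {ρ j} {φ j}
      (subst (λ ψ → LogProd 𝓕 𝓖 (φ i ⇔' ψ)) ρᵢ≡ρⱼ (proj₂ (proj₂ (repr (φ i)))))
      (LogProd-⇔'-sym {φ = φ j} {ρ j} (proj₂ (proj₂ (repr (φ j)))))

  locallyTabular⇒equivalentPair : {k : ℕ} → LocallyTabularProd 𝓕 𝓖 → (φ : ℕ → Fm (A ⊎ B) (Fin k)) →
    Σ[ i ∈ ℕ ] Σ[ j ∈ ℕ ] (i < j × LogProd 𝓕 𝓖 (φ i ⇔' φ j))
  locallyTabular⇒equivalentPair {k} lt = finiteRepresentatives⇒equivalentPair (proj₁ (lt k)) (proj₂ (lt k))

ψ : {a b : ℕ} → ℕ → ℕ → ℕ → Fm (Fin a ⊎ Fin b) (Fin 3)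
ψ k n s = colourChain (◇̄ k n) 0 s

-- RP_m is a disjunction, so refuting its negation needs excluded middle.
ψ-implication⇒RP : ExcludedMiddle 0ℓ → ∀ {a b k n} (F : Frame (Fin a)) (G : Frame (Fin b)) →
  KTransitive k F → KTransitive n G → ∀ {m j} → m < j →
  (F ⊗ G) ⊨ (ψ k n (suc m) ⇒' ψ k n (suc j)) → RP m (R* F G)
ψ-implication⇒RP em {k = k} {n} F G k-trans n-trans {m} {j} m<j ψₘ⇒ψⱼ x steps = decidable-stable em λ ¬rp →
  let withinOne = shortcutFree⇒withinOne F G x m path (λ i j i<j j≤m e → ¬rp (inj₂ (i , j , i<j , j≤m , e)))
      start = colourChain-start {f = ◇̄ k n} (◇̄-defines F G k-trans n-trans) x (suc m) path withinOne
  in <⇒≱ m<j (s≤s⁻¹ (to (start (suc j)) (ψₘ⇒ψⱼ (pathColouring x (suc m)) (x 0) (from (start (suc m)) ≤-refl))))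
  where
  path : IsPath (R* F G) x (suc m)
  path t t<1+m = steps t (s≤s⁻¹ t<1+m)

starProduct-RP : ExcludedMiddle 0ℓ → ∀ {a b k n} {𝓕 : Class (Fin a)} {𝓖 : Class (Fin b)} →
  (∀ F → 𝓕 F → KTransitive k F) → (∀ G → 𝓖 G → KTransitive n G) →
  LocallyTabularProd 𝓕 𝓖 → StarProductRP 𝓕 𝓖
starProduct-RP em {k = k} {n} k-trans n-trans lt =
  let m , j , m<j , ψₘ⇔ψⱼ = locallyTabular⇒equivalentPair lt (λ s → ψ k n (suc s))
  in m , λ F G F∈ G∈ →
       ψ-implication⇒RP em F G (k-trans F F∈) (n-trans G G∈) m<j (λ v u → proj₁ (ψₘ⇔ψⱼ F G F∈ G∈ v u))

proposition3p21 : ExcludedMiddle 0ℓ → ExcludedMiddle (Level.suc 0ℓ)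
    → (a b : ℕ) (k n : ℕ) (𝓕 : Class (Fin a)) (𝓖 : Class (Fin b))
    → (∀ F → 𝓕 F → KTransitive k F)
    → (∀ G → 𝓖 G → KTransitive n G)
    → LocallyTabularProd 𝓕 𝓖
    → StarProductRP 𝓕 𝓖
    × (Σ[ m ∈ ℕ ] (∀ F G → 𝓕 F → 𝓖 G → (F ⊗ G) ⊨ rpkn a b m k n))
proposition3p21 em _ a b k n 𝓕 𝓖 k-trans n-trans lt =
  let m , rpₘ = starProduct-RP em k-trans n-trans lt
  in (m , rpₘ) , m , λ F G F∈ G∈ →
       rp-valid (◇̄-defines F G (k-trans F F∈) (n-trans G G∈)) m (rpₘ F G F∈ G∈)
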